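{- For positive integers $i,r,s$, $$\overline{\mathbf{p}}_{i^r}\,\overline{\mathbf{p}}_{i^s}=\sum_{k\ge0}\binom rk\binom sk k!\, i^k\,\overline{\mathbf{p}}_{i^{r+s-k}}.$$ Moreover, if $\lambda$ is a partition with $m_i(\lambda)=0$, then $\overline{\mathbf{p}}_{i^r}\,\overline{\mathbf{p}}_\lambda=\overline{\mathbf{p}}_{(i^r)\cup\lambda}$, where $(i^r)\cup\lambda$ is the partition obtained by adding $r$ parts equal to $i$ to $\lambda$.
   Context: $Sym=\mathbb{Q}[p_1,p_2,\ldots]$ is the ring of symmetric functions (power sum generators $p_k$). For $i\ge1$ let $q_i=\frac1i\sum_{d\mid i}\mathrm{mob}(i/d)\,p_d$, where $\mathrm{mob}$ is the number-theoretic Möbius function, and let $(x)_r=x(x-1)\cdots(x-r+1)$ be the falling factorial. For $i,r\ge1$ set $\overline{\mathbf{p}}_{i^r}=i^r\,(q_i)_r$, and $\overline{\mathbf{p}}_{i^0}=1$. For a partition $\gamma$ with $m_i(\gamma)$ parts equal to $i$, $\overline{\mathbf{p}}_\gamma=\prod_{i\ge1}\overline{\mathbf{p}}_{i^{m_i(\gamma)}}$. -}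

module Defs where

open import Data.Nat as ℕ using (ℕ; zero; suc; NonZero; _≤?_; _≟_; _≥_; _>_; _⊔_)
open import Data.Nat.Divisibility using (_∣_; _∣?_)
open import Data.Nat.Primality using (Prime; prime?)
open import Data.Integer as ℤ using (ℤ; +_)
open import Data.Rational as ℚ using (ℚ; _/_)
open import Data.List using (List; []; _∷_; map; filter; length; upTo; foldr)
open import Data.Bool.ListAction using (any)
open import Data.List.Relation.Unary.All using (All)
open import Data.List.Relation.Unary.Linked using (Linked)
open import Data.Product using (_×_)
open import Relation.Nullary.Decidable using (_×-dec_; does)
open import Relation.Binary.PropositionalEquality using (_≡_)
open import Data.Bool using (if_then_else_)

-- Sym = ℚ[p₁, p₂, …] : polynomial expressions in the power sums,
-- identified when they agree as polynomial functions over ℚ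
-- (ℚ is infinite, so this is exactly equality in ℚ[p₁,p₂,…]).

infixl 6 _⊕_
infixl 7 _⊗_

data Sym : Set where
  con : ℚ → Sym
  var : ℕ → Sym                 -- var k is the power sum p_{k+1}
  _⊕_ : Sym → Sym → Sym
  _⊗_ : Sym → Sym → Sym

p : (k : ℕ) → .{{NonZero k}} → Sym
p (suc k) = var k

⟦_⟧ : Sym → (ℕ → ℚ) → ℚ
⟦ con c ⟧ ρ = c
⟦ var k ⟧ ρ = ρ k
⟦ f ⊕ g ⟧ ρ = ⟦ f ⟧ ρ ℚ.+ ⟦ g ⟧ ρ
⟦ f ⊗ g ⟧ ρ = ⟦ f ⟧ ρ ℚ.* ⟦ g ⟧ ρ

infix 4 _≈_
_≈_ : Sym → Sym → Set
f ≈ g = ∀ ρ → ⟦ f ⟧ ρ ≡ ⟦ g ⟧ ρ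

nat : ℕ → Sym
nat n = con (+ n / 1)

Σ-list : List Sym → Sym
Σ-list = foldr _⊕_ (con ℚ.0ℚ)

Π-list : List Sym → Sym
Π-list = foldr _⊗_ (con ℚ.1ℚ)

divisorsPlus : ℕ → List ℕ
divisorsPlus n = filter (λ d → d ∣? n) (map suc (upTo n))

primeDivisors : ℕ → List ℕ
primeDivisors n = filter (λ q → prime? q ×-dec (q ∣? n)) (upTo (suc n))

mob : ℕ → ℤ
mob n = if any (λ q → does ((q ℕ.* q) ∣? n)) (primeDivisors n)
        then + 0
        else (ℤ.- ℤ.1ℤ) ℤ.^ length (primeDivisors n)

-- q_i = (1/i) Σ_{d ∣ i} mob(i/d) p_d
qq : (i : ℕ) → .{{NonZero i}} → Sym
qq i = Σ-list (map (λ { (suc e) → con (mob (i ℕ./ suc e) / i) ⊗ var e ; zero → con ℚ.0ℚ })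
                   (divisorsPlus i))

falling : Sym → ℕ → Sym
falling x zero = con ℚ.1ℚ
falling x (suc r) = falling x r ⊗ (x ⊕ con (ℚ.- (+ r / 1)))

pbarPow : (i : ℕ) → .{{NonZero i}} → ℕ → Sym
pbarPow i zero = con ℚ.1ℚ
pbarPow i (suc r) = nat (i ℕ.^ suc r) ⊗ falling (qq i) (suc r)

IsPartition : List ℕ → Set
IsPartition γ = All (λ a → a > 0) γ × Linked _≥_ γ

mult : ℕ → List ℕ → ℕ
mult i γ = length (filter (λ a → a ≟ i) γ)

maxPart : List ℕ → ℕ
maxPart = foldr _⊔_ 0

-- \bar p_γ = Π_{i ≥ 1} \bar p_{i^{m_i(γ)}}  (factors with i > max part are 1)
pbar : List ℕ → Sym
pbar γ = Π-list (map (λ k → pbarPow (suc k) (mult (suc k) γ)) (upTo (maxPart γ)))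

insertPart : ℕ → List ℕ → List ℕ
insertPart x [] = x ∷ []
insertPart x (y ∷ ys) = if does (y ≤? x) then x ∷ y ∷ ys else y ∷ insertPart x ys

addParts : ℕ → ℕ → List ℕ → List ℕ
addParts i zero γ = γ
addParts i (suc r) γ = insertPart i (addParts i r γ)

-- Since p̄_{i^r} = i^r (q_i)_r, the first identity is i^{r+s} times the product formula
-- (x)_r (x)_s = Σ_k C(r,k) C(s,k) k! (x)_{r+s-k} for falling factorials, which follows by
-- induction on s from (x)_{r+s-k} (x - s) = (x)_{r+s+1-k} + (r - k) (x)_{r+s-k} and Pascal's rule.
-- For the second, p̄_λ is a product of one factor p̄_{j^{m_j(λ)}} per part size j; adding r parts
-- equal to i changes only the factor for j = i, from p̄_{i^0} = 1 to p̄_{i^r}.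
module Submission where

open import Algebra.Bundles using (Monoid; CommutativeMonoid; CommutativeRing)
open import Algebra.Core using (Op₂)
import Algebra.Properties.CommutativeMonoid.Sum as CommutativeMonoidSum
import Algebra.Properties.Monoid.Sum as MonoidSum
import Algebra.Properties.Semiring.Sum as SemiringSum
open import Data.Bool using (true; false)
open import Data.Fin using (Fin; toℕ; inject₁; fromℕ; fromℕ<)
open import Data.Fin.Properties using (toℕ-inject₁; toℕ-fromℕ; toℕ-fromℕ<; toℕ-injective; toℕ≤pred[n]; punchInᵢ≢i)
open import Data.Integer as ℤ using (+_)
import Data.Integer.Properties as ℤ
open import Data.List using (List; []; _∷_; length; map; foldr; applyUpTo; upTo)
open import Data.List.Properties using (filter-accept; filter-reject)
open import Data.List.Relation.Binary.Permutation.Propositional using (_↭_; ↭-refl; ↭-trans; ↭-prep; ↭-swap)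
open import Data.List.Relation.Binary.Permutation.Propositional.Properties using (↭-length; filter-↭)
open import Data.Nat as ℕ using (ℕ; zero; suc; NonZero; _+_; _*_; _∸_; _^_; _!; _≤_; _<_; _⊔_; _≟_; _≤?_; z≤n; s≤s)
import Data.Nat.Properties as ℕ
import Data.Nat.Solver as ℕ-Solver
open import Data.Nat.Combinatorics using (_C_; _P_; nCk≡nPk/k!; k>n⇒nCk≡0; nCk+nC[k+1]≡[n+1]C[k+1])
open import Data.Nat.Combinatorics.Base using (_P′_)
open import Data.Nat.Combinatorics.Specification using (k!∣nP′k; nPk≡n!/[n∸k]!; nP′k≡n!/[n∸k]!)
open import Data.Nat.Coprimality using (1-coprimeTo; sym)
open import Data.Nat.DivMod using (m/n*n≡m)
open import Data.Product using (_×_; _,_)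
open import Data.Rational as ℚ using (ℚ; mkℚ; _/_; 0ℚ; 1ℚ)
import Data.Rational.Properties as ℚ
import Data.Rational.Solver as ℚ-Solver
open import Data.Vec.Functional using (Vector; removeAt)
open import Function using (_∘_)
open import Relation.Binary.PropositionalEquality as ≡ using (_≡_; _≢_; refl; cong; cong₂; module ≡-Reasoning)
import Relation.Binary.Reasoning.Setoid as ≈-Reasoning
open import Relation.Nullary using (does)

module _ {c ℓ} (M : Monoid c ℓ) where
  open Monoid M
  open MonoidSum M using (sum; sum-syntax; sum-cong-≋; sum-replicate-zero)

  homo-foldr-applyUpTo : {A : Set} (h : A → Carrier) {_⊙_ : Op₂ A} {e : A} →
                         (∀ a b → h (a ⊙ b) ≈ h a ∙ h b) → h e ≈ ε →
                         ∀ (F : ℕ → A) (f : ℕ → ℕ) n →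
                         h (foldr _⊙_ e (map F (applyUpTo f n))) ≈ ∑[ k < n ] h (F (f (toℕ k)))
  homo-foldr-applyUpTo h homo homo-e F f zero    = homo-e
  homo-foldr-applyUpTo h homo homo-e F f (suc n) =
    trans (homo _ _) (∙-congˡ (homo-foldr-applyUpTo h homo homo-e F (f ∘ suc) n))

  sum-extend : ∀ {m n} (f : ℕ → Carrier) → m ≤ n → (∀ k → m ≤ k → f k ≈ ε) →
               ∑[ k < n ] f (toℕ k) ≈ ∑[ k < m ] f (toℕ k)
  sum-extend {zero}  {n}     f _         vanish =
    trans (sum-cong-≋ {n} (λ k → vanish (toℕ k) z≤n)) (sum-replicate-zero n)
  sum-extend {suc m} {suc n} f (s≤s m≤n) vanish =
    ∙-congˡ (sum-extend (f ∘ suc) m≤n (λ k m≤k → vanish (suc k) (s≤s m≤k)))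

module _ {c ℓ} (M : CommutativeMonoid c ℓ) where
  open CommutativeMonoid M
  open CommutativeMonoidSum M using (sum; sum-syntax; sum-cong-≋; sum-cong-≗; sum-remove; sum-init-last; ∑-distrib-+)
  open ≈-Reasoning setoid

  sum-update : ∀ {n} (f g : Vector Carrier n) (j : Fin n) → (∀ k → k ≢ j → f k ≈ g k) →
               g j ∙ sum f ≈ f j ∙ sum g
  sum-update {suc n} f g j f≈g-off-j = begin
    g j ∙ sum f                        ≈⟨ ∙-congˡ (sum-remove f) ⟩
    g j ∙ (f j ∙ sum (removeAt f j))   ≈⟨ x∙yz≈y∙xz (g j) (f j) _ ⟩
    f j ∙ (g j ∙ sum (removeAt f j))   ≈⟨ ∙-congˡ (∙-congˡ (sum-cong-≋ (λ k → f≈g-off-j _ (punchInᵢ≢i j k)))) ⟩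
    f j ∙ (g j ∙ sum (removeAt g j))   ≈⟨ ∙-congˡ (sum-remove g) ⟨
    f j ∙ sum g                        ∎
    where open import Algebra.Properties.CommutativeSemigroup commutativeSemigroup using (x∙yz≈y∙xz)

  sum-shift : ∀ n (f g : ℕ → Carrier) → g n ≈ ε →
              ∑[ k < suc n ] f (toℕ k) ∙ ∑[ k < suc n ] g (toℕ k)
                ≈ f 0 ∙ ∑[ k < n ] (f (suc (toℕ k)) ∙ g (toℕ k))
  sum-shift n f g gn≈ε = begin
    (f 0 ∙ ∑f′) ∙ ∑[ k < suc n ] g (toℕ k)
      ≈⟨ ∙-congˡ (sum-init-last {n} (g ∘ toℕ)) ⟩
    (f 0 ∙ ∑f′) ∙ (∑[ k < n ] g (toℕ (inject₁ k)) ∙ g (toℕ (fromℕ n)))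
      ≈⟨ ∙-congˡ (∙-cong (reflexive (sum-cong-≗ {n} (cong g ∘ toℕ-inject₁)))
                          (trans (reflexive (cong g (toℕ-fromℕ n))) gn≈ε)) ⟩
    (f 0 ∙ ∑f′) ∙ (∑g ∙ ε)
      ≈⟨ ∙-congˡ (identityʳ ∑g) ⟩
    (f 0 ∙ ∑f′) ∙ ∑g
      ≈⟨ assoc (f 0) ∑f′ ∑g ⟩
    f 0 ∙ (∑f′ ∙ ∑g)
      ≈⟨ ∙-congˡ (∑-distrib-+ {n} (f ∘ suc ∘ toℕ) (g ∘ toℕ)) ⟨
    f 0 ∙ ∑[ k < n ] (f (suc (toℕ k)) ∙ g (toℕ k)) ∎
    where
    ∑f′ = ∑[ k < n ] f (suc (toℕ k))
    ∑g  = ∑[ k < n ] g (toℕ k)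

-- Opened only now: its _≈_ would clash with the monoid equality used above.
open import Defs

open SemiringSum (CommutativeRing.semiring ℚ.+-*-commutativeRing)
  using (sum-syntax; sum-cong-≗; *-distribˡ-sum; *-distribʳ-sum; ∑-distrib-+)
open MonoidSum ℚ.*-1-monoid using () renaming (sum to ∏)

toℚ : ℕ → ℚ
toℚ n = + n / 1

toℚ≡mkℚ : ∀ n → toℚ n ≡ mkℚ (+ n) 0 (sym (1-coprimeTo n))
toℚ≡mkℚ n = ℚ.normalize-coprime (sym (1-coprimeTo n))

toℚ-homo-+ : ∀ m n → toℚ (m + n) ≡ toℚ m ℚ.+ toℚ n
toℚ-homo-+ m n = ≡.sym (begin
  toℚ m ℚ.+ toℚ n                    ≡⟨ cong₂ ℚ._+_ (toℚ≡mkℚ m) (toℚ≡mkℚ n) ⟩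
  (+ m ℤ.* + 1 ℤ.+ + n ℤ.* + 1) / 1  ≡⟨ cong (_/ 1) (cong₂ ℤ._+_ (ℤ.*-identityʳ (+ m)) (ℤ.*-identityʳ (+ n))) ⟩
  toℚ (m + n)                        ∎)
  where open ≡-Reasoning

toℚ-homo-* : ∀ m n → toℚ (m * n) ≡ toℚ m ℚ.* toℚ n
toℚ-homo-* m n = ≡.trans (cong (_/ 1) (ℤ.pos-* m n)) (≡.sym (cong₂ ℚ._*_ (toℚ≡mkℚ m) (toℚ≡mkℚ n)))

infixl 8 _↓_

_↓_ : ℚ → ℕ → ℚ
x ↓ zero  = 1ℚ
x ↓ suc n = x ↓ n ℚ.* (x ℚ.- toℚ n)

↓-*-shift : ∀ x m d → x ↓ (m + d) ℚ.* (x ℚ.- toℚ m) ≡ x ↓ suc (m + d) ℚ.+ toℚ d ℚ.* x ↓ (m + d)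
↓-*-shift x m d = begin
  f ℚ.* (x ℚ.- toℚ m)
    ≡⟨ solve 4 (λ f x m d → f :* (x :+ :- m) := f :* (x :+ :- (m :+ d)) :+ d :* f) refl f x (toℚ m) (toℚ d) ⟩
  f ℚ.* (x ℚ.- (toℚ m ℚ.+ toℚ d)) ℚ.+ toℚ d ℚ.* f
    ≡⟨ cong (λ y → f ℚ.* (x ℚ.- y) ℚ.+ toℚ d ℚ.* f) (toℚ-homo-+ m d) ⟨
  x ↓ suc (m + d) ℚ.+ toℚ d ℚ.* f ∎
  where
  open ≡-Reasoning
  open ℚ-Solver.+-*-Solver
  f = x ↓ (m + d)

module FallingProduct (x : ℚ) (r : ℕ) where
  open ≡-Reasoning

  -- (r P′ k) * (s C k) is C(r,k) C(s,k) k!, written so that r P′ suc k ≡ (r ∸ k) * (r P′ k) holds by definition.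
  term : ℕ → ℕ → ℚ
  term s k = toℚ ((r P′ k) * (s C k)) ℚ.* x ↓ (r + s ∸ k)

  term-*-shift : ∀ s k → k ≤ r →
    term s k ℚ.* (x ℚ.- toℚ s)
      ≡ toℚ ((r P′ k) * (s C k)) ℚ.* x ↓ (suc (r + s) ∸ k) ℚ.+ toℚ ((r P′ suc k) * (s C k)) ℚ.* x ↓ (r + s ∸ k)
  term-*-shift s k k≤r = begin
    (toℚ c ℚ.* x ↓ n) ℚ.* (x ℚ.- toℚ s)
      ≡⟨ ℚ.*-assoc (toℚ c) (x ↓ n) _ ⟩
    toℚ c ℚ.* (x ↓ n ℚ.* (x ℚ.- toℚ s))
      ≡⟨ cong (λ m → toℚ c ℚ.* (x ↓ m ℚ.* (x ℚ.- toℚ s))) n≡s+d ⟩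
    toℚ c ℚ.* (x ↓ (s + d) ℚ.* (x ℚ.- toℚ s))
      ≡⟨ cong (toℚ c ℚ.*_) (↓-*-shift x s d) ⟩
    toℚ c ℚ.* (x ↓ suc (s + d) ℚ.+ toℚ d ℚ.* x ↓ (s + d))
      ≡⟨ cong (λ m → toℚ c ℚ.* (x ↓ suc m ℚ.+ toℚ d ℚ.* x ↓ m)) n≡s+d ⟨
    toℚ c ℚ.* (x ↓ suc n ℚ.+ toℚ d ℚ.* x ↓ n)
      ≡⟨ ℚ.*-distribˡ-+ (toℚ c) (x ↓ suc n) _ ⟩
    toℚ c ℚ.* x ↓ suc n ℚ.+ toℚ c ℚ.* (toℚ d ℚ.* x ↓ n)
      ≡⟨ cong₂ (λ m e → toℚ c ℚ.* x ↓ m ℚ.+ e) (ℕ.+-∸-assoc 1 k≤r+s) (ℚ.*-assoc (toℚ c) (toℚ d) (x ↓ n)) ⟨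
    toℚ c ℚ.* x ↓ (suc (r + s) ∸ k) ℚ.+ toℚ c ℚ.* toℚ d ℚ.* x ↓ n
      ≡⟨ cong (λ e → toℚ c ℚ.* x ↓ (suc (r + s) ∸ k) ℚ.+ e ℚ.* x ↓ n) (≡.trans (≡.sym (toℚ-homo-* c d)) (cong toℚ c*d≡)) ⟩
    toℚ c ℚ.* x ↓ (suc (r + s) ∸ k) ℚ.+ toℚ ((r P′ suc k) * (s C k)) ℚ.* x ↓ n ∎
    where
    c = (r P′ k) * (s C k)
    d = r ∸ k
    n = r + s ∸ k
    k≤r+s = ℕ.≤-trans k≤r (ℕ.m≤m+n r s)
    n≡s+d : n ≡ s + d
    n≡s+d = ≡.trans (ℕ.+-∸-comm s k≤r) (ℕ.+-comm d s)
    c*d≡ : c * d ≡ (r P′ suc k) * (s C k)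
    c*d≡ = ≡.trans (ℕ.*-comm c d) (≡.sym (ℕ.*-assoc d (r P′ k) (s C k)))

  term-pascal : ∀ s j →
    toℚ ((r P′ suc j) * (s C suc j)) ℚ.* x ↓ (suc (r + s) ∸ suc j) ℚ.+ toℚ ((r P′ suc j) * (s C j)) ℚ.* x ↓ (r + s ∸ j)
      ≡ term (suc s) (suc j)
  term-pascal s j = begin
    toℚ (c * (s C suc j)) ℚ.* f ℚ.+ toℚ (c * (s C j)) ℚ.* f
      ≡⟨ ℚ.*-distribʳ-+ f (toℚ (c * (s C suc j))) _ ⟨
    (toℚ (c * (s C suc j)) ℚ.+ toℚ (c * (s C j))) ℚ.* f
      ≡⟨ cong (ℚ._* f) (toℚ-homo-+ (c * (s C suc j)) (c * (s C j))) ⟨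
    toℚ (c * (s C suc j) + c * (s C j)) ℚ.* f
      ≡⟨ cong (λ m → toℚ m ℚ.* f) (ℕ.*-distribˡ-+ c (s C suc j) (s C j)) ⟨
    toℚ (c * ((s C suc j) + (s C j))) ℚ.* f
      ≡⟨ cong (λ m → toℚ (c * m) ℚ.* f) (≡.trans (ℕ.+-comm (s C suc j) (s C j)) (nCk+nC[k+1]≡[n+1]C[k+1] s j)) ⟩
    toℚ (c * (suc s C suc j)) ℚ.* f
      ≡⟨ cong (λ m → toℚ (c * (suc s C suc j)) ℚ.* x ↓ (m ∸ suc j)) (ℕ.+-suc r s) ⟨
    term (suc s) (suc j) ∎
    where
    c = r P′ suc j
    f = x ↓ (r + s ∸ j)

  ↓-*-↓ : ∀ s → x ↓ r ℚ.* x ↓ s ≡ ∑[ k < suc r ] term s (toℕ k)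
  ↓-*-↓ zero = begin
    x ↓ r ℚ.* 1ℚ                   ≡⟨ ℚ.*-identityʳ (x ↓ r) ⟩
    x ↓ r                          ≡⟨ cong (x ↓_) (ℕ.+-identityʳ r) ⟨
    x ↓ (r + 0)                    ≡⟨ ℚ.*-identityˡ _ ⟨
    term 0 0                       ≡⟨ ℚ.+-identityʳ _ ⟨
    ∑[ k < 1 ] term 0 (toℕ k)      ≡⟨ sum-extend ℚ.+-0-monoid {1} {suc r} (term 0) (s≤s z≤n) term-0-vanish ⟨
    ∑[ k < suc r ] term 0 (toℕ k)  ∎
    where
    term-0-vanish : ∀ k → 1 ≤ k → term 0 k ≡ 0ℚ
    term-0-vanish (suc k) _ = ≡.trans (cong (λ c → toℚ c ℚ.* x ↓ (r + 0 ∸ suc k)) (ℕ.*-zeroʳ (r P′ suc k)))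
                                      (ℚ.*-zeroˡ (x ↓ (r + 0 ∸ suc k)))
  ↓-*-↓ (suc s) = begin
    x ↓ r ℚ.* (x ↓ s ℚ.* y)
      ≡⟨ ℚ.*-assoc (x ↓ r) (x ↓ s) y ⟨
    x ↓ r ℚ.* x ↓ s ℚ.* y
      ≡⟨ cong (ℚ._* y) (↓-*-↓ s) ⟩
    (∑[ k < suc r ] term s (toℕ k)) ℚ.* y
      ≡⟨ *-distribʳ-sum {suc r} y (term s ∘ toℕ) ⟩
    ∑[ k < suc r ] (term s (toℕ k) ℚ.* y)
      ≡⟨ sum-cong-≗ {suc r} (λ k → term-*-shift s (toℕ k) (toℕ≤pred[n] k)) ⟩
    ∑[ k < suc r ] (f (toℕ k) ℚ.+ g (toℕ k))
      ≡⟨ ∑-distrib-+ {suc r} (f ∘ toℕ) (g ∘ toℕ) ⟩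
    ∑[ k < suc r ] f (toℕ k) ℚ.+ ∑[ k < suc r ] g (toℕ k)
      ≡⟨ sum-shift ℚ.+-0-commutativeMonoid r f g g-last ⟩
    f 0 ℚ.+ ∑[ k < r ] (f (suc (toℕ k)) ℚ.+ g (toℕ k))
      ≡⟨ cong₂ ℚ._+_ (cong (λ m → toℚ 1 ℚ.* x ↓ m) (≡.sym (ℕ.+-suc r s))) (sum-cong-≗ {r} (term-pascal s ∘ toℕ)) ⟩
    ∑[ k < suc r ] term (suc s) (toℕ k) ∎
    where
    y = x ℚ.- toℚ s
    f g : ℕ → ℚ
    f k = toℚ ((r P′ k) * (s C k)) ℚ.* x ↓ (suc (r + s) ∸ k)
    g k = toℚ ((r P′ suc k) * (s C k)) ℚ.* x ↓ (r + s ∸ k)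
    g-last : g r ≡ 0ℚ
    g-last = ≡.trans (cong (λ c → toℚ (c * (r P′ r) * (s C r)) ℚ.* x ↓ (r + s ∸ r)) (ℕ.n∸n≡0 r))
                     (ℚ.*-zeroˡ (x ↓ (r + s ∸ r)))

open FallingProduct using (↓-*-↓)

nCk*k!≡nP′k : ∀ {n k} → k ≤ n → (n C k) * k ! ≡ n P′ k
nCk*k!≡nP′k {n} {k} k≤n = begin
  (n C k) * k !               ≡⟨ cong (_* k !) (nCk≡nPk/k! k≤n) ⟩
  ((n P k) ℕ./ k !) * k !     ≡⟨ cong (λ m → (m ℕ./ k !) * k !) (≡.trans (nPk≡n!/[n∸k]! k≤n) (≡.sym (nP′k≡n!/[n∸k]! k≤n))) ⟩
  ((n P′ k) ℕ./ k !) * k !    ≡⟨ m/n*n≡m (k!∣nP′k k≤n) ⟩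
  n P′ k                      ∎
  where
  open ≡-Reasoning
  instance _ = ℕ._!≢0 k

⟦Σ-list-upTo⟧ : ∀ (F : ℕ → Sym) n ρ → ⟦ Σ-list (map F (upTo n)) ⟧ ρ ≡ ∑[ k < n ] ⟦ F (toℕ k) ⟧ ρ
⟦Σ-list-upTo⟧ F n ρ = homo-foldr-applyUpTo ℚ.+-0-monoid (λ f → ⟦ f ⟧ ρ) (λ _ _ → refl) refl F (λ k → k) n

⟦falling⟧ : ∀ y n ρ → ⟦ falling y n ⟧ ρ ≡ ⟦ y ⟧ ρ ↓ n
⟦falling⟧ y zero    ρ = refl
⟦falling⟧ y (suc n) ρ = cong (ℚ._* (⟦ y ⟧ ρ ℚ.- toℚ n)) (⟦falling⟧ y n ρ)

⟦pbarPow⟧ : ∀ i .{{_ : NonZero i}} n ρ → ⟦ pbarPow i n ⟧ ρ ≡ toℚ (i ^ n) ℚ.* ⟦ qq i ⟧ ρ ↓ n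
⟦pbarPow⟧ i zero    ρ = refl
⟦pbarPow⟧ i (suc n) ρ = cong (toℚ (i ^ suc n) ℚ.*_) (⟦falling⟧ (qq i) (suc n) ρ)

pbarPow-coefficient : ∀ i r s {k} → k ≤ r →
  (r C k) * (s C k) * k ! * i ^ k * i ^ (r + s ∸ k) ≡ i ^ (r + s) * ((r P′ k) * (s C k))
pbarPow-coefficient i r s {k} k≤r = begin
  (r C k) * (s C k) * k ! * i ^ k * i ^ (r + s ∸ k)
    ≡⟨ solve 5 (λ a b c d e → a :* b :* c :* d :* e := (a :* c) :* b :* (d :* e)) refl (r C k) (s C k) (k !) (i ^ k) (i ^ (r + s ∸ k)) ⟩
  (r C k) * k ! * (s C k) * (i ^ k * i ^ (r + s ∸ k))
    ≡⟨ cong₂ (λ a b → a * (s C k) * b) (nCk*k!≡nP′k k≤r) (≡.sym (ℕ.^-distribˡ-+-* i k (r + s ∸ k))) ⟩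
  (r P′ k) * (s C k) * i ^ (k + (r + s ∸ k))
    ≡⟨ cong (λ m → (r P′ k) * (s C k) * i ^ m) (ℕ.m+[n∸m]≡n (ℕ.≤-trans k≤r (ℕ.m≤m+n r s))) ⟩
  (r P′ k) * (s C k) * i ^ (r + s)
    ≡⟨ ℕ.*-comm ((r P′ k) * (s C k)) (i ^ (r + s)) ⟩
  i ^ (r + s) * ((r P′ k) * (s C k)) ∎
  where
  open ≡-Reasoning
  open ℕ-Solver.+-*-Solver

pbarPow-*-pbarPow : ∀ i .{{_ : NonZero i}} r s →
  pbarPow i r ⊗ pbarPow i s
    ≈ Σ-list (map (λ k → nat ((r C k) * (s C k) * (k !) * (i ^ k)) ⊗ pbarPow i (r + s ∸ k)) (upTo (suc (r + s))))
pbarPow-*-pbarPow i r s ρ = begin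
  ⟦ pbarPow i r ⟧ ρ ℚ.* ⟦ pbarPow i s ⟧ ρ
    ≡⟨ cong₂ ℚ._*_ (⟦pbarPow⟧ i r ρ) (⟦pbarPow⟧ i s ρ) ⟩
  (toℚ (i ^ r) ℚ.* x ↓ r) ℚ.* (toℚ (i ^ s) ℚ.* x ↓ s)
    ≡⟨ solve 4 (λ a u b v → (a :* u) :* (b :* v) := (a :* b) :* (u :* v)) refl (toℚ (i ^ r)) (x ↓ r) (toℚ (i ^ s)) (x ↓ s) ⟩
  (toℚ (i ^ r) ℚ.* toℚ (i ^ s)) ℚ.* (x ↓ r ℚ.* x ↓ s)
    ≡⟨ cong₂ ℚ._*_ (≡.trans (≡.sym (toℚ-homo-* (i ^ r) (i ^ s))) (cong toℚ (≡.sym (ℕ.^-distribˡ-+-* i r s)))) (↓-*-↓ x r s) ⟩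
  toℚ (i ^ (r + s)) ℚ.* ∑[ k < suc r ] term (toℕ k)
    ≡⟨ *-distribˡ-sum {suc r} (toℚ (i ^ (r + s))) (term ∘ toℕ) ⟩
  ∑[ k < suc r ] (toℚ (i ^ (r + s)) ℚ.* term (toℕ k))
    ≡⟨ sum-cong-≗ {suc r} (λ k → rescale (toℕ≤pred[n] k)) ⟩
  ∑[ k < suc r ] ⟦ F (toℕ k) ⟧ ρ
    ≡⟨ sum-extend ℚ.+-0-monoid {suc r} {suc (r + s)} (λ k → ⟦ F k ⟧ ρ) (s≤s (ℕ.m≤m+n r s)) F-vanish ⟨
  ∑[ k < suc (r + s) ] ⟦ F (toℕ k) ⟧ ρ
    ≡⟨ ⟦Σ-list-upTo⟧ F (suc (r + s)) ρ ⟨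
  ⟦ Σ-list (map F (upTo (suc (r + s)))) ⟧ ρ ∎
  where
  open ≡-Reasoning
  open ℚ-Solver.+-*-Solver using (solve; _:=_; _:*_)
  x = ⟦ qq i ⟧ ρ
  term = FallingProduct.term x r s
  F : ℕ → Sym
  F k = nat ((r C k) * (s C k) * (k !) * (i ^ k)) ⊗ pbarPow i (r + s ∸ k)
  rescale : ∀ {k} → k ≤ r → toℚ (i ^ (r + s)) ℚ.* term k ≡ ⟦ F k ⟧ ρ
  rescale {k} k≤r = begin
    toℚ (i ^ (r + s)) ℚ.* (toℚ c ℚ.* f)        ≡⟨ ℚ.*-assoc (toℚ (i ^ (r + s))) (toℚ c) f ⟨
    toℚ (i ^ (r + s)) ℚ.* toℚ c ℚ.* f          ≡⟨ cong (ℚ._* f) (toℚ-homo-* (i ^ (r + s)) c) ⟨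
    toℚ (i ^ (r + s) * c) ℚ.* f                ≡⟨ cong (λ m → toℚ m ℚ.* f) (pbarPow-coefficient i r s k≤r) ⟨
    toℚ (c′ * i ^ (r + s ∸ k)) ℚ.* f           ≡⟨ cong (ℚ._* f) (toℚ-homo-* c′ (i ^ (r + s ∸ k))) ⟩
    toℚ c′ ℚ.* toℚ (i ^ (r + s ∸ k)) ℚ.* f     ≡⟨ ℚ.*-assoc (toℚ c′) (toℚ (i ^ (r + s ∸ k))) f ⟩
    toℚ c′ ℚ.* (toℚ (i ^ (r + s ∸ k)) ℚ.* f)   ≡⟨ cong (toℚ c′ ℚ.*_) (⟦pbarPow⟧ i (r + s ∸ k) ρ) ⟨
    ⟦ F k ⟧ ρ                                  ∎
    where
    c = (r P′ k) * (s C k)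
    c′ = (r C k) * (s C k) * (k !) * (i ^ k)
    f = x ↓ (r + s ∸ k)
  F-vanish : ∀ k → suc r ≤ k → ⟦ F k ⟧ ρ ≡ 0ℚ
  F-vanish k r<k = ≡.trans (cong (λ m → toℚ (m * (s C k) * (k !) * (i ^ k)) ℚ.* ⟦ pbarPow i (r + s ∸ k) ⟧ ρ) (k>n⇒nCk≡0 r<k))
                           (ℚ.*-zeroˡ (⟦ pbarPow i (r + s ∸ k) ⟧ ρ))

insertPart-↭ : ∀ x ys → insertPart x ys ↭ x ∷ ys
insertPart-↭ x []       = ↭-refl
insertPart-↭ x (y ∷ ys) with does (y ≤? x)
... | true  = ↭-refl
... | false = ↭-trans (↭-prep y (insertPart-↭ x ys)) (↭-swap y x ↭-refl)

mult-↭ : ∀ j {xs ys} → xs ↭ ys → mult j xs ≡ mult j ys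
mult-↭ j xs↭ys = ↭-length (filter-↭ (_≟ j) xs↭ys)

mult-addParts-≡ : ∀ i r γ → mult i (addParts i r γ) ≡ r + mult i γ
mult-addParts-≡ i zero    γ = refl
mult-addParts-≡ i (suc r) γ = begin
  mult i (insertPart i γ′) ≡⟨ mult-↭ i (insertPart-↭ i γ′) ⟩
  mult i (i ∷ γ′)          ≡⟨ cong length (filter-accept (_≟ i) refl) ⟩
  suc (mult i γ′)          ≡⟨ cong suc (mult-addParts-≡ i r γ) ⟩
  suc (r + mult i γ)       ∎
  where
  open ≡-Reasoning
  γ′ = addParts i r γ

mult-addParts-≢ : ∀ {i j} r γ → i ≢ j → mult j (addParts i r γ) ≡ mult j γ
mult-addParts-≢         zero    γ i≢j = refl
mult-addParts-≢ {i} {j} (suc r) γ i≢j = begin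
  mult j (insertPart i γ′) ≡⟨ mult-↭ j (insertPart-↭ i γ′) ⟩
  mult j (i ∷ γ′)          ≡⟨ cong length (filter-reject (_≟ j) i≢j) ⟩
  mult j γ′                ≡⟨ mult-addParts-≢ r γ i≢j ⟩
  mult j γ                 ∎
  where
  open ≡-Reasoning
  γ′ = addParts i r γ

mult-≡0 : ∀ j γ → maxPart γ < j → mult j γ ≡ 0
mult-≡0 j []      _   = refl
mult-≡0 j (a ∷ γ) γ<j =
  ≡.trans (cong length (filter-reject (_≟ j) a≢j)) (mult-≡0 j γ (ℕ.≤-<-trans (ℕ.m≤n⊔m a (maxPart γ)) γ<j))
  where
  a≢j : a ≢ j
  a≢j refl = ℕ.<-irrefl refl (ℕ.≤-<-trans (ℕ.m≤m⊔n a (maxPart γ)) γ<j)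

maxPart-insertPart : ∀ x ys → maxPart (insertPart x ys) ≡ x ⊔ maxPart ys
maxPart-insertPart x []       = refl
maxPart-insertPart x (y ∷ ys) with does (y ≤? x)
... | true  = refl
... | false = ≡.trans (cong (y ⊔_) (maxPart-insertPart x ys)) (x∙yz≈y∙xz y x (maxPart ys))
  where open import Algebra.Properties.CommutativeSemigroup ℕ.⊔-commutativeSemigroup using (x∙yz≈y∙xz)

maxPart-addParts : ∀ i r γ → maxPart (addParts i r γ) ≤ i ⊔ maxPart γ
maxPart-addParts i zero    γ = ℕ.m≤n⊔m i (maxPart γ)
maxPart-addParts i (suc r) γ = ℕ.≤-trans (ℕ.≤-reflexive (maxPart-insertPart i (addParts i r γ)))
                                         (ℕ.⊔-lub (ℕ.m≤m⊔n i (maxPart γ)) (maxPart-addParts i r γ))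

pbarFactor : List ℕ → ℕ → Sym
pbarFactor γ k = pbarPow (suc k) (mult (suc k) γ)

⟦pbar⟧ : ∀ γ {n} → maxPart γ ≤ n → ∀ ρ → ⟦ pbar γ ⟧ ρ ≡ ∏ {n} (λ k → ⟦ pbarFactor γ (toℕ k) ⟧ ρ)
⟦pbar⟧ γ {n} γ≤n ρ = begin
  ⟦ pbar γ ⟧ ρ
    ≡⟨ homo-foldr-applyUpTo ℚ.*-1-monoid (λ f → ⟦ f ⟧ ρ) (λ _ _ → refl) refl (pbarFactor γ) (λ k → k) (maxPart γ) ⟩
  ∏ {maxPart γ} (λ k → ⟦ pbarFactor γ (toℕ k) ⟧ ρ)
    ≡⟨ sum-extend ℚ.*-1-monoid {maxPart γ} {n} (λ k → ⟦ pbarFactor γ k ⟧ ρ) γ≤n factor-trivial ⟨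
  ∏ {n} (λ k → ⟦ pbarFactor γ (toℕ k) ⟧ ρ) ∎
  where
  open ≡-Reasoning
  factor-trivial : ∀ k → maxPart γ ≤ k → ⟦ pbarFactor γ k ⟧ ρ ≡ 1ℚ
  factor-trivial k γ≤k = cong (λ m → ⟦ pbarPow (suc k) m ⟧ ρ) (mult-≡0 (suc k) γ (s≤s γ≤k))

pbarPow-pbar : ∀ i .{{_ : NonZero i}} r γ → mult i γ ≡ 0 → pbarPow i r ⊗ pbar γ ≈ pbar (addParts i r γ)
pbarPow-pbar (suc i) r γ i∉γ ρ = begin
  ⟦ pbarPow (suc i) r ⟧ ρ ℚ.* ⟦ pbar γ ⟧ ρ ≡⟨ cong₂ ℚ._*_ pbarPow-at-j (⟦pbar⟧ γ (ℕ.m≤n⊔m (suc i) (maxPart γ)) ρ) ⟩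
  h′ j ℚ.* ∏ h                             ≡⟨ sum-update ℚ.*-1-commutativeMonoid h′ h j h′≡h-off-j ⟨
  h j ℚ.* ∏ h′                             ≡⟨ cong (ℚ._* ∏ h′) h-at-j ⟩
  1ℚ ℚ.* ∏ h′                              ≡⟨ ℚ.*-identityˡ (∏ h′) ⟩
  ∏ h′                                     ≡⟨ ⟦pbar⟧ γ′ (maxPart-addParts (suc i) r γ) ρ ⟨
  ⟦ pbar γ′ ⟧ ρ                            ∎
  where
  open ≡-Reasoning
  n = suc i ⊔ maxPart γ
  γ′ = addParts (suc i) r γ
  j : Fin n
  j = fromℕ< (ℕ.m≤m⊔n (suc i) (maxPart γ))
  h h′ : Fin n → ℚ
  h k = ⟦ pbarFactor γ (toℕ k) ⟧ ρ
  h′ k = ⟦ pbarFactor γ′ (toℕ k) ⟧ ρ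
  factor-at-j : ∀ δ → ⟦ pbarFactor δ (toℕ j) ⟧ ρ ≡ ⟦ pbarPow (suc i) (mult (suc i) δ) ⟧ ρ
  factor-at-j δ = cong (λ k → ⟦ pbarFactor δ k ⟧ ρ) (toℕ-fromℕ< (ℕ.m≤m⊔n (suc i) (maxPart γ)))
  h-at-j : h j ≡ 1ℚ
  h-at-j = ≡.trans (factor-at-j γ) (cong (λ m → ⟦ pbarPow (suc i) m ⟧ ρ) i∉γ)
  pbarPow-at-j : ⟦ pbarPow (suc i) r ⟧ ρ ≡ h′ j
  pbarPow-at-j = ≡.sym (≡.trans (factor-at-j γ′) (cong (λ m → ⟦ pbarPow (suc i) m ⟧ ρ)
                   (≡.trans (mult-addParts-≡ (suc i) r γ) (≡.trans (cong (λ m → r + m) i∉γ) (ℕ.+-identityʳ r)))))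
  h′≡h-off-j : ∀ k → k ≢ j → h′ k ≡ h k
  h′≡h-off-j k k≢j = cong (λ m → ⟦ pbarPow (suc (toℕ k)) m ⟧ ρ) (mult-addParts-≢ r γ i≢k)
    where
    i≢k : suc i ≢ suc (toℕ k)
    i≢k i≡k = k≢j (toℕ-injective (≡.trans (ℕ.suc-injective (≡.sym i≡k)) (≡.sym (toℕ-fromℕ< _))))

-- IsPartition γ is unused: the second identity holds for every list γ.
mainTheorem3 : (i r s : ℕ) → .{{_ : NonZero i}} → .{{_ : NonZero r}} → .{{_ : NonZero s}}
    → (pbarPow i r ⊗ pbarPow i s
        ≈ Σ-list (map (λ k → nat ((r C k) * (s C k) * (k !) * (i ^ k)) ⊗ pbarPow i (r + s ∸ k))
                      (upTo (suc (r + s)))))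
      × ((γ : List ℕ) → IsPartition γ → mult i γ ≡ 0
          → pbarPow i r ⊗ pbar γ ≈ pbar (addParts i r γ))
mainTheorem3 i r s = pbarPow-*-pbarPow i r s , λ γ _ → pbarPow-pbar i r γ
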